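{- Let $S=(V,E)$ be a connected undirected graph and let $u\in V$ be a deletable vertex of $S$. Then at most one articulation point of $S$ becomes a deletable vertex of $S\setminus\{u\}$ (the graph obtained from $S$ by deleting $u$ and its incident edges). That is, there is at most one vertex $w\in V\setminus\{u\}$ such that $w$ is an articulation point of $S$ and $w$ is a deletable vertex of $S\setminus\{u\}$.
   Context: A vertex of a connected graph is an articulation point if removing the vertex together with its incident edges disconnects the graph. A vertex is called a deletable vertex if it is not an articulation point (a non-articulation point). -}

module Defs where

open import Level using (Level; 0ℓ; suc)
open import Data.Nat using (ℕ)
open import Data.Fin using (Fin)
open import Data.Unit using (⊤)
open import Data.Product using (_×_)
open import Relation.Nullary using (¬_)
open import Relation.Binary.PropositionalEquality using (_≡_; _≢_)

record Graph (n : ℕ) : Set₁ where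
  field
    Adj : Fin n → Fin n → Set
    sym : ∀ {x y} → Adj x y → Adj y x
open Graph public

VSet : ℕ → Set₁
VSet n = Fin n → Set

full : ∀ {n} → VSet n
full _ = ⊤

-- Remove a vertex (together with its incident edges: we work with induced subgraphs).
_∖_ : ∀ {n} → VSet n → Fin n → VSet n
(P ∖ v) x = P x × x ≢ v

data Walk {n} (G : Graph n) (P : VSet n) : Fin n → Fin n → Set where
  here : ∀ {x} → P x → Walk G P x x
  step : ∀ {x y z} → P x → Adj G x y → Walk G P y z → Walk G P x z

Connected : ∀ {n} → Graph n → VSet n → Set
Connected G P = ∀ x y → P x → P y → Walk G P x y

ArticulationPoint : ∀ {n} → Graph n → VSet n → Fin n → Set
ArticulationPoint G P v = P v × ¬ Connected G (P ∖ v)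

Deletable : ∀ {n} → Graph n → VSet n → Fin n → Set
Deletable G P v = P v × Connected G (P ∖ v)

-- If w is a cut vertex of S that stops being one once u is deleted, then every
-- neighbour z ≠ u of u is w: otherwise u hangs off the connected graph
-- S ∖ {u, w} through z, so S ∖ w would already be connected.  Since u has at
-- least one neighbour other than itself, there is at most one such w.
module Submission where

open import Defs
open import Data.Fin using (Fin; _≟_)
open import Data.Product using (_×_; _,_; proj₁; ∃)
open import Data.Unit using (tt)
open import Relation.Nullary using (yes; no)
open import Data.Empty using (⊥-elim)
open import Relation.Binary.PropositionalEquality
  using (_≡_; _≢_; refl; trans; ≢-sym) renaming (sym to ≡-sym)

module _ {n} (G : Graph n) where

  mapWalk : ∀ {P Q : VSet n} → (∀ {x} → P x → Q x) → ∀ {x y} → Walk G P x y → Walk G Q x y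
  mapWalk f (here p)     = here (f p)
  mapWalk f (step p a w) = step (f p) a (mapWalk f w)

  source∈ : ∀ {P x y} → Walk G P x y → P x
  source∈ (here p)     = p
  source∈ (step p _ _) = p

  _++_ : ∀ {P x y z} → Walk G P x y → Walk G P y z → Walk G P x z
  here _     ++ w′ = w′
  step p a w ++ w′ = step p a (w ++ w′)

  reverse : ∀ {P x y} → Walk G P x y → Walk G P y x
  reverse (here p)     = here p
  reverse (step p a w) = reverse w ++ step (source∈ w) (sym G a) (here p)

  Connected-resp : ∀ {P Q : VSet n} → (∀ {x} → P x → Q x) → (∀ {x} → Q x → P x) →
                   Connected G P → Connected G Q
  Connected-resp P⊆Q Q⊆P C x y qx qy = mapWalk P⊆Q (C x y (Q⊆P qx) (Q⊆P qy))

  -- Self-loops are allowed, so the neighbour must be found where the walk first leaves x.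
  walk⇒neighbour : ∀ {P x y} → x ≢ y → Walk G P x y → ∃ λ z → Adj G x z × z ≢ x
  walk⇒neighbour x≢y (here _) = ⊥-elim (x≢y refl)
  walk⇒neighbour {x = x} x≢y (step {y = y} _ a w) with y ≟ x
  ... | yes refl = walk⇒neighbour x≢y w
  ... | no y≢x   = y , a , y≢x

  Connected-attach : ∀ {P u z} → Connected G (P ∖ u) → P u → Adj G u z → (P ∖ u) z →
                     Connected G P
  Connected-attach {P} {u} {z} C pu a z∈ x y px py = walkToZ x px ++ reverse (walkToZ y py)
    where
    walkToZ : ∀ x → P x → Walk G P x z
    walkToZ x px with x ≟ u
    ... | yes refl = step px a (here (proj₁ z∈))
    ... | no x≢u   = mapWalk proj₁ (C x z (px , x≢u) z∈)

neighbour≡revivedCutVertex :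
  ∀ {n} (S : Graph n) {u w z : Fin n} →
  ArticulationPoint S full w → Deletable S (full ∖ u) w →
  Adj S u z → z ≢ u → z ≡ w
neighbour≡revivedCutVertex S {u} {w} {z} (_ , cut) ((_ , w≢u) , C) a z≢u with z ≟ w
... | yes z≡w = z≡w
... | no z≢w  = ⊥-elim (cut (Connected-attach S S∖w∖u (tt , ≢-sym w≢u) a ((tt , z≢w) , z≢u)))
  where
  S∖w∖u : Connected S ((full ∖ w) ∖ u)
  S∖w∖u = Connected-resp S (λ { ((t , x≢u) , x≢w) → (t , x≢w) , x≢u })
                           (λ { ((t , x≢w) , x≢u) → (t , x≢u) , x≢w }) C

lemma1 : ∀ {n} (S : Graph n) → Connected S full → (u : Fin n) → Deletable S full u →
    ∀ (w₁ w₂ : Fin n) → w₁ ≢ u → w₂ ≢ u →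
    ArticulationPoint S full w₁ → Deletable S (full ∖ u) w₁ →
    ArticulationPoint S full w₂ → Deletable S (full ∖ u) w₂ →
    w₁ ≡ w₂
lemma1 S C u _ w₁ w₂ w₁≢u _ cut₁ del₁ cut₂ del₂
  with walk⇒neighbour S (≢-sym w₁≢u) (C u w₁ tt tt)
... | z , a , z≢u =
  trans (≡-sym (neighbour≡revivedCutVertex S cut₁ del₁ a z≢u))
        (neighbour≡revivedCutVertex S cut₂ del₂ a z≢u)
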